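{- Let $(\lambda/\mu,r)$ be an r-shape, let $n\ge\lambda_1$, and let $\mathbf a,\mathbf b\in\mathbb Z^n$ be column flags for it, with conjugate flags $\mathbf a',\mathbf b'$. Give the conjugate skew diagram $\lambda'/\mu'$ the r-shape structure whose content function is $c^*(j,i)=-c(i,j)$ (the conjugate r-shape). Then $$\mathsf S^{\mathbf a,\mathbf b}_{\lambda/\mu}(\mathbf y/\mathbf z)=\overline{\mathsf S}^{\mathbf a',\mathbf b'}_{\lambda'/\mu'}(\overline{\mathbf z}/\overline{\mathbf y}).$$
   Context: Partitions $\lambda\supseteq\mu$, conjugate partitions $\lambda',\mu'$, $\ell(\lambda)$ the length; the skew diagram $\lambda/\mu=\{(i,j):\mu_i<j\le\lambda_i\}$ in English notation (row $i$ from the top, column $j$ from the left). An r-shape $(\lambda/\mu,r)$ is a skew diagram together with an integer $r$ (root content); the shifted content of a position $(i,j)\in\mathbb Z^2$ is $c(i,j)=j-i+r-1+\lambda'_1$ (the usual shape has $r=1-\lambda'_1$, i.e. $c(i,j)=j-i$). For finite sets of variables, $e_n(\mathbf x/\mathbf y)=\sum_{i=0}^n(-1)^{n-i}e_i(\mathbf x)h_{n-i}(\mathbf y)$ and $h_n(\mathbf x/\mathbf y)=\sum_{i=0}^n(-1)^{n-i}h_i(\mathbf x)e_{n-i}(\mathbf y)$ (ordinary elementary and complete homogeneous symmetric polynomials $e_i,h_i$), both $0$ for $n<0$. For doubly infinite variables $\mathbf y=(y_i)_{i\in\mathbb Z}$, $\mathbf z=(z_i)_{i\in\mathbb Z}$: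 $\mathbf y_{a,b}=(y_a,\dots,y_b)$ if $a\le b$, empty if $a>b$; $\overline{\mathbf y}=(-y_i)_{i\in\mathbb Z}$. Column flags for $(\lambda/\mu,r)$ (with $n\ge\lambda_1$) are $\mathbf a,\mathbf b\in\mathbb Z^n$ such that $a_i-a_{i+1}\le\mu'_i-\mu'_{i+1}+1$ and $b_i-b_{i+1}\le\lambda'_i-\lambda'_{i+1}+1$ for every $i$ with $\mu'_i<\lambda'_{i+1}$. Their conjugate flags are $a'_i=a_i+c(\mu'_i+1,i)$, $b'_i=b_i+c(\lambda'_i,i)$ (contents of the top and bottom cells of column $i$). The flagged supersymmetric Schur function is $\mathsf S^{\mathbf a,\mathbf b}_{\lambda/\mu}(\mathbf y/\mathbf z)=\det\big[e_{\lambda'_i-i-\mu'_j+j}(\mathbf y_{a_j,b_i}/\mathbf z_{a'_j,b'_i})\big]_{1\le i,j\le n}$. For an r-shape $\kappa/\nu$ with content function $c$ and $n\ge\ell(\kappa)$, row flags are $\mathbf a',\mathbf b'\in\mathbb Z^n$ with $a'_i\le a'_{i+1}$ and $b'_i\le b'_{i+1}$ whenever $\nu_i<\kappa_{i+1}$; set $a_j=a'_j+c(j,\nu_j+1)$, $b_i=b'_i+c(i,\kappa_i)$ (contents of the leftmost and rightmost cells of the row), and define the row flagged supersymmetric Schur function $\overline{\mathsf S}^{\mathbf a',\mathbf b'}_{\kappa/\nu}(\mathbf y/\mathbf z)=\det\big[h_{\kappa_i-\nu_j-i+j}(\mathbf y_{a'_j,b'_i}/\mathbf z_{a_j,b_i})\big]_{1\le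 i,j\le n}$. -}

module Defs where

open import Level using (Level)
open import Data.Nat as ℕ using (ℕ; zero; suc; _≤?_)
open import Data.Integer as ℤ using (ℤ; +_; -[1+_])
open import Data.List using (List; []; _∷_; map; filter; length; upTo)
open import Data.List.Relation.Unary.All using (All)
open import Data.List.Relation.Unary.Linked using (Linked)
open import Data.Fin using (Fin; toℕ; punchIn)
import Data.Fin as Fin
open import Algebra.Bundles using (CommutativeRing)
open import Relation.Nullary using (yes; no)
open import Data.Product using (_×_)
open import Relation.Binary.PropositionalEquality using (_≡_)

IsPartition : List ℕ → Set
IsPartition λ₀ = Linked ℕ._≥_ λ₀ × All (ℕ._<_ 0) λ₀

-- 1-based part:  part λ i = λ_i  (and 0 for i = 0 or i > ℓ(λ)).
part : List ℕ → ℕ → ℕ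
part []       _             = 0
part (x ∷ xs) zero          = 0
part (x ∷ xs) (suc zero)    = x
part (x ∷ xs) (suc (suc i)) = part xs (suc i)

conj : List ℕ → List ℕ
conj λ₀ = map (λ j → length (filter (λ x → suc j ≤? x) λ₀)) (upTo (part λ₀ 1))

_⊆ₚ_ : List ℕ → List ℕ → Set
μ ⊆ₚ λ₀ = ∀ i → part μ i ℕ.≤ part λ₀ i

content : List ℕ → ℤ → ℤ → ℤ → ℤ
content λ₀ r i j = j ℤ.- i ℤ.+ r ℤ.- + 1 ℤ.+ + part (conj λ₀) 1

range : ℤ → ℤ → List ℤ
range a b with a ℤ.≤? b
... | yes _ = map (λ k → a ℤ.+ + k) (upTo (suc ℤ.∣ b ℤ.- a ∣))
... | no _  = []

-- Column flags for (λ/μ, r) with n entries (index i : Fin n stands for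
-- the 1-based index 1 + toℕ i).

IsColumnFlags : List ℕ → List ℕ → (n : ℕ) → (Fin n → ℤ) → (Fin n → ℤ) → Set
IsColumnFlags λ₀ μ n a b =
  (∀ (i j : Fin n) → toℕ j ≡ suc (toℕ i) →
     part μ' (suc (toℕ i)) ℕ.< part λ' (suc (toℕ j)) →
     a i ℤ.- a j ℤ.≤ (+ part μ' (suc (toℕ i)) ℤ.- + part μ' (suc (toℕ j))) ℤ.+ + 1)
  × (∀ (i j : Fin n) → toℕ j ≡ suc (toℕ i) →
     part μ' (suc (toℕ i)) ℕ.< part λ' (suc (toℕ j)) →
     b i ℤ.- b j ℤ.≤ (+ part λ' (suc (toℕ i)) ℤ.- + part λ' (suc (toℕ j))) ℤ.+ + 1)
  where
  λ' = conj λ₀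
  μ' = conj μ

conjFlagA : List ℕ → List ℕ → ℤ → (n : ℕ) → (Fin n → ℤ) → (Fin n → ℤ)
conjFlagA λ₀ μ r n a i =
  a i ℤ.+ content λ₀ r (+ suc (part (conj μ) (suc (toℕ i)))) (+ suc (toℕ i))

conjFlagB : List ℕ → List ℕ → ℤ → (n : ℕ) → (Fin n → ℤ) → (Fin n → ℤ)
conjFlagB λ₀ μ r n b i =
  b i ℤ.+ content λ₀ r (+ part (conj λ₀) (suc (toℕ i))) (+ suc (toℕ i))

module RingDefs {c ℓ : Level} (R : CommutativeRing c ℓ) where
  open CommutativeRing R

  sumℕ : ℕ → (ℕ → Carrier) → Carrier
  sumℕ zero    f = 0#
  sumℕ (suc m) f = sumℕ m f + f m

  sumFin : (n : ℕ) → (Fin n → Carrier) → Carrier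
  sumFin zero    f = 0#
  sumFin (suc n) f = f Fin.zero + sumFin n (λ k → f (Fin.suc k))

  alt : ℕ → Carrier → Carrier
  alt zero    x = x
  alt (suc k) x = - alt k x

  e : ℕ → List Carrier → Carrier
  e zero    _        = 1#
  e (suc k) []       = 0#
  e (suc k) (x ∷ xs) = x * e k xs + e (suc k) xs

  h : ℕ → List Carrier → Carrier
  h zero    _        = 1#
  h (suc k) []       = 0#
  h (suc k) (x ∷ xs) = x * h k (x ∷ xs) + h (suc k) xs

  eS : ℤ → List Carrier → List Carrier → Carrier
  eS -[1+ _ ] xs ys = 0#
  eS (+ m)    xs ys = sumℕ (suc m) (λ i → alt (m ℕ.∸ i) (e i xs * h (m ℕ.∸ i) ys))

  hS : ℤ → List Carrier → List Carrier → Carrier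
  hS -[1+ _ ] xs ys = 0#
  hS (+ m)    xs ys = sumℕ (suc m) (λ i → alt (m ℕ.∸ i) (h i xs * e (m ℕ.∸ i) ys))

  det : (n : ℕ) → (Fin n → Fin n → Carrier) → Carrier
  det zero    M = 1#
  det (suc n) M = sumFin (suc n) (λ j →
    alt (toℕ j) (M Fin.zero j * det n (λ k l → M (Fin.suc k) (punchIn j l))))

  vars : (ℤ → Carrier) → ℤ → ℤ → List Carrier
  vars y a b = map y (range a b)

  colSchur : (λ₀ μ : List ℕ) (r : ℤ) (n : ℕ) (a b : Fin n → ℤ)
             (y z : ℤ → Carrier) → Carrier
  colSchur λ₀ μ r n a b y z = det n (λ i j →
      eS ((+ part λ' (suc (toℕ i)) ℤ.- + suc (toℕ i))
            ℤ.- + part μ' (suc (toℕ j)) ℤ.+ + suc (toℕ j))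
         (vars y (a j) (b i))
         (vars z (conjFlagA λ₀ μ r n a j) (conjFlagB λ₀ μ r n b i)))
    where
    λ' = conj λ₀
    μ' = conj μ

  rowSchur : (κ ν : List ℕ) (r : ℤ) (n : ℕ) (a' b' : Fin n → ℤ)
             (y z : ℤ → Carrier) → Carrier
  rowSchur κ ν r n a' b' y z = det n (λ i j →
      hS (((+ part κ (suc (toℕ i)) ℤ.- + part ν (suc (toℕ j)))
            ℤ.- + suc (toℕ i)) ℤ.+ + suc (toℕ j))
         (vars y (a' j) (b' i))
         (vars z (aa j) (bb i)))
    where
    aa : Fin n → ℤ
    aa j = a' j ℤ.+ content κ r (+ suc (toℕ j)) (+ suc (part ν (suc (toℕ j))))
    bb : Fin n → ℤ
    bb i = b' i ℤ.+ content κ r (+ suc (toℕ i)) (+ part κ (suc (toℕ i)))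

-- The identity holds entry by entry, so none of the shape or flag conditions
-- is needed.  Negating all variables multiplies e_k and h_k by (-1)^k, so
-- h_m(-z/-y) = Σ_i (-1)^i h_i(z) e_{m-i}(y), which is e_m(y/z) summed in the
-- reverse order.  The degrees of corresponding entries agree, and the row-flag
-- contents c* = -c undo the shift by c that turned the column flags a, b into
-- a', b', so the variable ranges agree too.
module Submission where

open import Defs
open import Level using (Level)
open import Function using (_∘_)
open import Data.Nat as ℕ using (ℕ; zero; suc; _∸_)
import Data.Nat.Properties as ℕ
open import Data.Integer as ℤ using (ℤ; +_)
open import Data.Integer.Tactic.RingSolver using (solve-∀)
open import Data.List using (List; []; _∷_; map)
open import Data.List.Properties using (map-∘)
open import Data.Fin using (Fin; toℕ; punchIn)
import Data.Fin as Fin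
open import Relation.Binary.PropositionalEquality as ≡ using (_≡_; cong; cong₂)
open import Algebra.Bundles using (CommutativeRing)
import Algebra.Properties.Ring as RingProperties
import Relation.Binary.Reasoning.Setoid as SetoidReasoning

module SupersymmetricDuality {c ℓ : Level} (R : CommutativeRing c ℓ) where
  open CommutativeRing R
  open RingDefs R
  open RingProperties ring
  open SetoidReasoning setoid

  alt-cong : ∀ k {x y} → x ≈ y → alt k x ≈ alt k y
  alt-cong zero    x≈y = x≈y
  alt-cong (suc k) x≈y = -‿cong (alt-cong k x≈y)

  alt-zero : ∀ k → alt k 0# ≈ 0#
  alt-zero zero    = refl
  alt-zero (suc k) = trans (-‿cong (alt-zero k)) -0#≈0#

  alt-distrib-+ : ∀ k x y → alt k (x + y) ≈ alt k x + alt k y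
  alt-distrib-+ zero    x y = refl
  alt-distrib-+ (suc k) x y = trans (-‿cong (alt-distrib-+ k x y)) (sym (-‿+-comm _ _))

  alt-*ˡ : ∀ k x y → alt k x * y ≈ alt k (x * y)
  alt-*ˡ zero    x y = refl
  alt-*ˡ (suc k) x y = trans (sym (-‿distribˡ-* _ y)) (-‿cong (alt-*ˡ k x y))

  alt-*ʳ : ∀ k x y → x * alt k y ≈ alt k (x * y)
  alt-*ʳ zero    x y = refl
  alt-*ʳ (suc k) x y = trans (sym (-‿distribʳ-* x _)) (-‿cong (alt-*ʳ k x y))

  alt-‿-comm : ∀ k x → alt k (- x) ≈ - alt k x
  alt-‿-comm zero    x = refl
  alt-‿-comm (suc k) x = -‿cong (alt-‿-comm k x)

  alt-comm : ∀ k l x → alt k (alt l x) ≈ alt l (alt k x)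
  alt-comm k zero    x = refl
  alt-comm k (suc l) x = trans (alt-‿-comm k _) (-‿cong (alt-comm k l x))

  alt-involutive : ∀ k x → alt k (alt k x) ≈ x
  alt-involutive zero    x = refl
  alt-involutive (suc k) x =
    trans (-‿cong (trans (alt-‿-comm k _) (-‿cong (alt-involutive k x)))) (-‿involutive x)

  neg-*-alt : ∀ k x y → - x * alt k y ≈ alt (suc k) (x * y)
  neg-*-alt k x y = trans (sym (-‿distribˡ-* x _)) (-‿cong (alt-*ʳ k x y))

  e-map-neg : ∀ k xs → e k (map -_ xs) ≈ alt k (e k xs)
  e-map-neg zero    xs       = refl
  e-map-neg (suc k) []       = sym (alt-zero (suc k))
  e-map-neg (suc k) (x ∷ xs) = begin
    - x * e k (map -_ xs) + e (suc k) (map -_ xs)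
      ≈⟨ +-cong (*-congˡ (e-map-neg k xs)) (e-map-neg (suc k) xs) ⟩
    - x * alt k (e k xs) + alt (suc k) (e (suc k) xs)
      ≈⟨ +-congʳ (neg-*-alt k x _) ⟩
    alt (suc k) (x * e k xs) + alt (suc k) (e (suc k) xs)
      ≈⟨ alt-distrib-+ (suc k) _ _ ⟨
    alt (suc k) (e (suc k) (x ∷ xs)) ∎

  h-map-neg : ∀ k xs → h k (map -_ xs) ≈ alt k (h k xs)
  h-map-neg zero    xs       = refl
  h-map-neg (suc k) []       = sym (alt-zero (suc k))
  h-map-neg (suc k) (x ∷ xs) = begin
    - x * h k (map -_ (x ∷ xs)) + h (suc k) (map -_ xs)
      ≈⟨ +-cong (*-congˡ (h-map-neg k (x ∷ xs))) (h-map-neg (suc k) xs) ⟩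
    - x * alt k (h k (x ∷ xs)) + alt (suc k) (h (suc k) xs)
      ≈⟨ +-congʳ (neg-*-alt k x _) ⟩
    alt (suc k) (x * h k (x ∷ xs)) + alt (suc k) (h (suc k) xs)
      ≈⟨ alt-distrib-+ (suc k) _ _ ⟨
    alt (suc k) (h (suc k) (x ∷ xs)) ∎

  sumℕ-cong : ∀ m {f g : ℕ → Carrier} → (∀ i → i ℕ.< m → f i ≈ g i) →
              sumℕ m f ≈ sumℕ m g
  sumℕ-cong zero    f≈g = refl
  sumℕ-cong (suc m) f≈g =
    +-cong (sumℕ-cong m (λ i i<m → f≈g i (ℕ.m<n⇒m<1+n i<m))) (f≈g m (ℕ.n<1+n m))

  sumℕ-unfoldˡ : ∀ m f → sumℕ (suc m) f ≈ f 0 + sumℕ m (f ∘ suc)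
  sumℕ-unfoldˡ zero    f = trans (+-identityˡ _) (sym (+-identityʳ _))
  sumℕ-unfoldˡ (suc m) f = trans (+-congʳ (sumℕ-unfoldˡ m f)) (+-assoc _ _ _)

  sumℕ-reverse : ∀ m f → sumℕ (suc m) f ≈ sumℕ (suc m) (λ i → f (m ∸ i))
  sumℕ-reverse zero    f = refl
  sumℕ-reverse (suc m) f = begin
    sumℕ (suc (suc m)) f
      ≈⟨ sumℕ-unfoldˡ (suc m) f ⟩
    f 0 + sumℕ (suc m) (f ∘ suc)
      ≈⟨ +-comm _ _ ⟩
    sumℕ (suc m) (f ∘ suc) + f 0
      ≈⟨ +-cong (sumℕ-reverse m (f ∘ suc)) (reflexive (cong f (≡.sym (ℕ.n∸n≡0 m)))) ⟩
    sumℕ (suc m) (λ i → f (suc (m ∸ i))) + f (m ∸ m)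
      ≈⟨ +-congʳ (sumℕ-cong (suc m) λ i i≤m →
           reflexive (cong f (≡.sym (ℕ.+-∸-assoc 1 (ℕ.≤-pred i≤m))))) ⟩
    sumℕ (suc (suc m)) (λ i → f (suc m ∸ i)) ∎

  eS-duality : ∀ m xs ys → eS m xs ys ≈ hS m (map -_ ys) (map -_ xs)
  eS-duality ℤ.-[1+ _ ] xs ys = refl
  eS-duality (ℤ.+ m)    xs ys = sym (begin
    sumℕ (suc m) (λ i → alt (m ∸ i) (h i (map -_ ys) * e (m ∸ i) (map -_ xs)))
      ≈⟨ sumℕ-cong (suc m) (λ i _ → signs-cancel i) ⟩
    sumℕ (suc m) term
      ≈⟨ sumℕ-reverse m term ⟩
    sumℕ (suc m) (λ i → term (m ∸ i))
      ≈⟨ sumℕ-cong (suc m) (λ i i≤m → reversed-term i (ℕ.≤-pred i≤m)) ⟩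
    sumℕ (suc m) (λ i → alt (m ∸ i) (e i xs * h (m ∸ i) ys)) ∎)
    where
    term : ℕ → Carrier
    term i = alt i (h i ys * e (m ∸ i) xs)

    signs-cancel : ∀ i → alt (m ∸ i) (h i (map -_ ys) * e (m ∸ i) (map -_ xs)) ≈ term i
    signs-cancel i = begin
      alt (m ∸ i) (h i (map -_ ys) * e (m ∸ i) (map -_ xs))
        ≈⟨ alt-cong (m ∸ i) (*-cong (h-map-neg i ys) (e-map-neg (m ∸ i) xs)) ⟩
      alt (m ∸ i) (alt i (h i ys) * alt (m ∸ i) (e (m ∸ i) xs))
        ≈⟨ alt-cong (m ∸ i) (trans (alt-*ˡ i _ _) (alt-cong i (alt-*ʳ (m ∸ i) _ _))) ⟩
      alt (m ∸ i) (alt i (alt (m ∸ i) (h i ys * e (m ∸ i) xs)))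
        ≈⟨ alt-cong (m ∸ i) (alt-comm i (m ∸ i) _) ⟩
      alt (m ∸ i) (alt (m ∸ i) (term i))
        ≈⟨ alt-involutive (m ∸ i) _ ⟩
      term i ∎

    reversed-term : ∀ i → i ℕ.≤ m → term (m ∸ i) ≈ alt (m ∸ i) (e i xs * h (m ∸ i) ys)
    reversed-term i i≤m = alt-cong (m ∸ i)
      (trans (*-congˡ (reflexive (cong (λ k → e k xs) (ℕ.m∸[m∸n]≡n i≤m)))) (*-comm _ _))

  eS-vars-duality : ∀ {m m' a₀ b₀} (y z : ℤ → Carrier) (a b a' b' : ℤ) →
                    m ≡ m' → a₀ ≡ a → b₀ ≡ b →
                    eS m (vars y a b) (vars z a' b') ≈
                    hS m' (vars (-_ ∘ z) a' b') (vars (-_ ∘ y) a₀ b₀)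
  eS-vars-duality {m} y z a b a' b' ≡.refl ≡.refl ≡.refl = begin
    eS m (vars y a b) (vars z a' b')
      ≈⟨ eS-duality m _ _ ⟩
    hS m (map -_ (vars z a' b')) (map -_ (vars y a b))
      ≡⟨ cong₂ (hS m) (map-∘ (range a' b')) (map-∘ (range a b)) ⟨
    hS m (vars (-_ ∘ z) a' b') (vars (-_ ∘ y) a b) ∎

  sumFin-cong : ∀ n {f g : Fin n → Carrier} → (∀ i → f i ≈ g i) → sumFin n f ≈ sumFin n g
  sumFin-cong zero    f≈g = refl
  sumFin-cong (suc n) f≈g = +-cong (f≈g Fin.zero) (sumFin-cong n (f≈g ∘ Fin.suc))

  det-cong : ∀ n {M N : Fin n → Fin n → Carrier} → (∀ i j → M i j ≈ N i j) → det n M ≈ det n N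
  det-cong zero    M≈N = refl
  det-cong (suc n) M≈N = sumFin-cong (suc n) λ j → alt-cong (toℕ j)
    (*-cong (M≈N Fin.zero j) (det-cong n λ k l → M≈N (Fin.suc k) (punchIn j l)))

degree-reorder : ∀ (p q s t : ℤ) → (p ℤ.- q) ℤ.- s ℤ.+ t ≡ ((p ℤ.- s) ℤ.- q) ℤ.+ t
degree-reorder = solve-∀

+-cancel-neg : ∀ {u d d'} → d' ≡ ℤ.- d → (u ℤ.+ d) ℤ.+ d' ≡ u
+-cancel-neg {u} {d} ≡.refl = cancel u d
  where
  cancel : ∀ (u d : ℤ) → (u ℤ.+ d) ℤ.+ ℤ.- d ≡ u
  cancel = solve-∀

mainTheorem1 : {c ℓ : Level} (R : CommutativeRing c ℓ) →
    (λ₀ μ : List ℕ) → IsPartition λ₀ → IsPartition μ → μ ⊆ₚ λ₀ →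
    (r : ℤ) (n : ℕ) → part λ₀ 1 ℕ.≤ n →
    (a b : Fin n → ℤ) → IsColumnFlags λ₀ μ n a b →
    (r* : ℤ) → (∀ (i j : ℤ) → content (conj λ₀) r* j i ≡ ℤ.- content λ₀ r i j) →
    (y z : ℤ → CommutativeRing.Carrier R) →
    CommutativeRing._≈_ R
      (RingDefs.colSchur R λ₀ μ r n a b y z)
      (RingDefs.rowSchur R (conj λ₀) (conj μ) r* n
        (conjFlagA λ₀ μ r n a) (conjFlagB λ₀ μ r n b)
        (λ k → CommutativeRing.-_ R (z k)) (λ k → CommutativeRing.-_ R (y k)))
mainTheorem1 R λ₀ μ _ _ _ r n _ a b _ r* c*≡-c y z =
  det-cong n λ i j → eS-vars-duality y z (a j) (b i) (a' j) (b' i)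
    (degree-reorder (+ part λ' (suc (toℕ i))) (+ suc (toℕ i))
                    (+ part μ' (suc (toℕ j))) (+ suc (toℕ j)))
    (+-cancel-neg (c*≡-c (+ suc (part μ' (suc (toℕ j)))) (+ suc (toℕ j))))
    (+-cancel-neg (c*≡-c (+ part λ' (suc (toℕ i))) (+ suc (toℕ i))))
  where
  open SupersymmetricDuality R
  λ' μ' : List ℕ
  λ' = conj λ₀
  μ' = conj μ
  a' b' : Fin n → ℤ
  a' = conjFlagA λ₀ μ r n a
  b' = conjFlagB λ₀ μ r n b
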